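{- The class of pure and trivial double Boolean algebras is congruence-distributive, i.e. for every pure and trivial double Boolean algebra $\underline{D}$ the congruence lattice $\mathrm{Con}(\underline{D})$ is distributive.
   Context: A double Boolean algebra (dBa) is an algebra $\underline{D}=(D;\sqcap,\sqcup,\neg,\lrcorner,\bot,\top)$ of type $(2,2,1,1,0,0)$ satisfying, for all $x,y,z$, where $x\vee y:=\neg(\neg x\sqcap\neg y)$ and $x\wedge y:=\lrcorner(\lrcorner x\sqcup\lrcorner y)$: $(x\sqcap x)\sqcap y=x\sqcap y$; $(x\sqcup x)\sqcup y=x\sqcup y$; $\sqcap$ and $\sqcup$ are commutative and associative; $x\sqcap(x\sqcup y)=x\sqcap x$; $x\sqcup(x\sqcap y)=x\sqcup x$; $x\sqcap(x\vee y)=x\sqcap x$; $x\sqcup(x\wedge y)=x\sqcup x$; $x\sqcap(y\vee z)=(x\sqcap y)\vee(x\sqcap z)$; $x\sqcup(y\wedge z)=(x\sqcup y)\wedge(x\sqcup z)$; $\neg\neg(x\sqcap y)=x\sqcap y$; $\lrcorner\lrcorner(x\sqcup y)=x\sqcup y$; $\neg(x\sqcap x)=\neg x$; $\lrcorner(x\sqcup x)=\lrcorner x$; $x\sqcap\neg x=\bot$; $x\sqcup\lrcorner x=\top$; $\neg\bot=\top\sqcap\top$; $\lrcorner\top=\bot\sqcup\bot$; $\neg\top=\bot$; $\lrcorner\bot=\top$; $(x\sqcap x)\sqcup(x\sqcap x)=(x\sqcup x)\sqcap(x\sqcup x)$. $\underline{D}$ is pure if every $x$ satisfies $x\sqcap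 x=x$ or $x\sqcup x=x$, and trivial if $\top\sqcap\top=\bot\sqcup\bot$. Congruences are equivalence relations compatible with $\sqcap,\sqcup,\neg,\lrcorner$. -}

module Defs where

open import Level using (Level; suc)
open import Relation.Binary.PropositionalEquality using (_≡_)
open import Relation.Binary.Core using (Rel)
open import Relation.Binary.Structures using (IsEquivalence)
open import Data.Product using (_×_; _,_)
open import Data.Sum using (_⊎_)

record DBA (a : Level) : Set (suc a) where
  infixr 7 _⊓_
  infixr 6 _⊔_
  field
    Carrier : Set a
    _⊓_ _⊔_ : Carrier → Carrier → Carrier
    ¬_ ⌟_ : Carrier → Carrier
    ⊥ ⊤ : Carrier

  _∨_ : Carrier → Carrier → Carrier
  x ∨ y = ¬ ((¬ x) ⊓ (¬ y))

  _∧_ : Carrier → Carrier → Carrier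
  x ∧ y = ⌟ ((⌟ x) ⊔ (⌟ y))

  field
    ⊓-idem-l : ∀ x y → (x ⊓ x) ⊓ y ≡ x ⊓ y
    ⊔-idem-l : ∀ x y → (x ⊔ x) ⊔ y ≡ x ⊔ y
    ⊓-comm   : ∀ x y → x ⊓ y ≡ y ⊓ x
    ⊔-comm   : ∀ x y → x ⊔ y ≡ y ⊔ x
    ⊓-assoc  : ∀ x y z → (x ⊓ y) ⊓ z ≡ x ⊓ (y ⊓ z)
    ⊔-assoc  : ∀ x y z → (x ⊔ y) ⊔ z ≡ x ⊔ (y ⊔ z)
    ⊓-abs-⊔  : ∀ x y → x ⊓ (x ⊔ y) ≡ x ⊓ x
    ⊔-abs-⊓  : ∀ x y → x ⊔ (x ⊓ y) ≡ x ⊔ x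
    ⊓-abs-∨  : ∀ x y → x ⊓ (x ∨ y) ≡ x ⊓ x
    ⊔-abs-∧  : ∀ x y → x ⊔ (x ∧ y) ≡ x ⊔ x
    ⊓-distrib-∨ : ∀ x y z → x ⊓ (y ∨ z) ≡ (x ⊓ y) ∨ (x ⊓ z)
    ⊔-distrib-∧ : ∀ x y z → x ⊔ (y ∧ z) ≡ (x ⊔ y) ∧ (x ⊔ z)
    ¬¬-⊓     : ∀ x y → ¬ (¬ (x ⊓ y)) ≡ x ⊓ y
    ⌟⌟-⊔     : ∀ x y → ⌟ (⌟ (x ⊔ y)) ≡ x ⊔ y
    ¬-⊓-idem : ∀ x → ¬ (x ⊓ x) ≡ ¬ x
    ⌟-⊔-idem : ∀ x → ⌟ (x ⊔ x) ≡ ⌟ x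
    ⊓-compl  : ∀ x → x ⊓ (¬ x) ≡ ⊥
    ⊔-compl  : ∀ x → x ⊔ (⌟ x) ≡ ⊤
    ¬⊥       : ¬ ⊥ ≡ ⊤ ⊓ ⊤
    ⌟⊤       : ⌟ ⊤ ≡ ⊥ ⊔ ⊥
    ¬⊤       : ¬ ⊤ ≡ ⊥
    ⌟⊥       : ⌟ ⊥ ≡ ⊤
    mixed    : ∀ x → (x ⊓ x) ⊔ (x ⊓ x) ≡ (x ⊔ x) ⊓ (x ⊔ x)

module _ {a : Level} (D : DBA a) where
  open DBA D

  Pure : Set a
  Pure = ∀ x → (x ⊓ x ≡ x) ⊎ (x ⊔ x ≡ x)

  Trivial : Set a
  Trivial = ⊤ ⊓ ⊤ ≡ ⊥ ⊔ ⊥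

  record Congruence : Set (suc a) where
    field
      R       : Rel Carrier a
      isEquiv : IsEquivalence R
      ⊓-cong  : ∀ {x x′ y y′} → R x x′ → R y y′ → R (x ⊓ y) (x′ ⊓ y′)
      ⊔-cong  : ∀ {x x′ y y′} → R x x′ → R y y′ → R (x ⊔ y) (x′ ⊔ y′)
      ¬-cong  : ∀ {x x′} → R x x′ → R (¬ x) (¬ x′)
      ⌟-cong  : ∀ {x x′} → R x x′ → R (⌟ x) (⌟ x′)

module _ {a : Level} {A : Set a} where

  _∩_ : Rel A a → Rel A a → Rel A a
  (R ∩ S) x y = R x y × S x y

  data Join (R S : Rel A a) : Rel A a where
    step-l : ∀ {x y} → R x y → Join R S x y
    step-r : ∀ {x y} → S x y → Join R S x y
    trans  : ∀ {x y z} → Join R S x y → Join R S y z → Join R S x z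

  _≐_ : Rel A a → Rel A a → Set a
  R ≐ S = (∀ {x y} → R x y → S x y) × (∀ {x y} → S x y → R x y)

ConDistributive : ∀ {a} (D : DBA a) → Set (suc a)
ConDistributive D =
  (θ φ ψ : Congruence D) →
  let open Congruence in
  (R θ ∩ Join (R φ) (R ψ)) ≐ Join (R θ ∩ R φ) (R θ ∩ R ψ)

{-# OPTIONS --safe #-}
module Submission where

-- On the ⊓-idempotents a double Boolean algebra is a Boolean algebra, so the majority
-- term m(p, w, q) = (p ⊓ w) ∨ ((p ∨ w) ⊓ q) is available there. The usual Jónsson
-- argument, applied to a (φ ∨ ψ)-chain after squaring it into the idempotents, shows
-- θ ∩ (φ ∨ ψ) ⊆ (θ ∩ φ) ∨ (θ ∩ ψ) on the squares x ⊓ x, y ⊓ y, and dually on x ⊔ x,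
-- y ⊔ y. In a pure trivial algebra every element is ⊓- or ⊔-idempotent, and if x is
-- ⊓-idempotent and y is ⊔-idempotent, the remaining squares x ⊔ x and y ⊓ y both equal
-- ⊤ ⊓ ⊤, the unique doubly idempotent element; this glues the two halves together.

open import Level using (Level)
open import Data.Product using (_,_)
open import Data.Sum using (inj₁; inj₂)
open import Relation.Binary.Core using (Rel; _Preserves_⟶_; _Preserves₂_⟶_⟶_)
open import Relation.Binary.Definitions using (Reflexive; Transitive)
open import Relation.Binary.Structures using (IsEquivalence)
open import Relation.Binary.PropositionalEquality as Eq
  using (_≡_; sym; cong; cong₂; subst; subst₂; module ≡-Reasoning)
open import Defs

module _ {a : Level} {A : Set a} where

  _Preserves₃_ : (A → A → A → A) → Rel A a → Set a
  m Preserves₃ R = ∀ {p p′ w w′ q q′} → R p p′ → R w w′ → R q q′ → R (m p w q) (m p′ w′ q′)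

  Join-map : ∀ {φ ψ : Rel A a} (f : A → A) → f Preserves φ ⟶ φ → f Preserves ψ ⟶ ψ →
             ∀ {x y} → Join φ ψ x y → Join φ ψ (f x) (f y)
  Join-map f fφ fψ (step-l r)  = step-l (fφ r)
  Join-map f fφ fψ (step-r r)  = step-r (fψ r)
  Join-map f fφ fψ (trans j k) = trans (Join-map f fφ fψ j) (Join-map f fφ fψ k)

  Join-∩⊆∩-Join : ∀ {θ φ ψ : Rel A a} → Transitive θ →
                  ∀ {x y} → Join (θ ∩ φ) (θ ∩ ψ) x y → (θ ∩ Join φ ψ) x y
  Join-∩⊆∩-Join θ-trans (step-l (t , r)) = t , step-l r
  Join-∩⊆∩-Join θ-trans (step-r (t , r)) = t , step-r r
  Join-∩⊆∩-Join θ-trans (trans j k) with Join-∩⊆∩-Join θ-trans j | Join-∩⊆∩-Join θ-trans k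
  ... | t , r | t′ , r′ = θ-trans t t′ , trans r r′

  majority⇒∩-Join⊆Join-∩ :
    ∀ {θ φ ψ : Rel A a} → IsEquivalence θ → Reflexive φ → Reflexive ψ →
    (m : A → A → A → A) → m Preserves₃ θ → m Preserves₃ φ → m Preserves₃ ψ →
    ∀ {p q} → (∀ w → m p w p ≡ p) → m p p q ≡ p → m p q q ≡ q →
    θ p q → Join φ ψ p q → Join (θ ∩ φ) (θ ∩ ψ) p q
  majority⇒∩-Join⊆Join-∩ {θ} {φ} {ψ} θ-equiv φ-refl ψ-refl m mθ mφ mψ {p} {q}
    m-pwp m-ppq m-pqq θpq j = subst₂ (Join (θ ∩ φ) (θ ∩ ψ)) m-ppq m-pqq (along j)
    where
    open IsEquivalence θ-equiv renaming (refl to θ-refl; sym to θ-sym; trans to θ-trans)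

    θ-to-p : ∀ w → θ (m p w q) p
    θ-to-p w = subst (θ (m p w q)) (m-pwp w) (mθ θ-refl θ-refl (θ-sym θpq))

    θ-along : ∀ u v → θ (m p u q) (m p v q)
    θ-along u v = θ-trans (θ-to-p u) (θ-sym (θ-to-p v))

    along : ∀ {u v} → Join φ ψ u v → Join (θ ∩ φ) (θ ∩ ψ) (m p u q) (m p v q)
    along (step-l r)  = step-l (θ-along _ _ , mφ φ-refl r φ-refl)
    along (step-r r)  = step-r (θ-along _ _ , mψ ψ-refl r ψ-refl)
    along (trans j k) = trans (along j) (along k)

dual : ∀ {a} → DBA a → DBA a
dual D = record
  { Carrier     = Carrier
  ; _⊓_         = _⊔_
  ; _⊔_         = _⊓_
  ; ¬_          = ⌟_
  ; ⌟_          = ¬_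
  ; ⊥           = ⊤
  ; ⊤           = ⊥
  ; ⊓-idem-l    = ⊔-idem-l
  ; ⊔-idem-l    = ⊓-idem-l
  ; ⊓-comm      = ⊔-comm
  ; ⊔-comm      = ⊓-comm
  ; ⊓-assoc     = ⊔-assoc
  ; ⊔-assoc     = ⊓-assoc
  ; ⊓-abs-⊔     = ⊔-abs-⊓
  ; ⊔-abs-⊓     = ⊓-abs-⊔
  ; ⊓-abs-∨     = ⊔-abs-∧
  ; ⊔-abs-∧     = ⊓-abs-∨
  ; ⊓-distrib-∨ = ⊔-distrib-∧
  ; ⊔-distrib-∧ = ⊓-distrib-∨
  ; ¬¬-⊓        = ⌟⌟-⊔
  ; ⌟⌟-⊔        = ¬¬-⊓
  ; ¬-⊓-idem    = ⌟-⊔-idem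
  ; ⌟-⊔-idem    = ¬-⊓-idem
  ; ⊓-compl     = ⊔-compl
  ; ⊔-compl     = ⊓-compl
  ; ¬⊥          = ⌟⊤
  ; ⌟⊤          = ¬⊥
  ; ¬⊤          = ⌟⊥
  ; ⌟⊥          = ¬⊤
  ; mixed       = λ x → sym (mixed x)
  }
  where open DBA D

Congruence-dual : ∀ {a} {D : DBA a} → Congruence D → Congruence (dual D)
Congruence-dual θ = record
  { R       = R
  ; isEquiv = isEquiv
  ; ⊓-cong  = ⊔-cong
  ; ⊔-cong  = ⊓-cong
  ; ¬-cong  = ⌟-cong
  ; ⌟-cong  = ¬-cong
  }
  where open Congruence θ

module _ {a : Level} (D : DBA a) where
  open DBA D
  open ≡-Reasoning

  ⊓-square-idem : ∀ x → (x ⊓ x) ⊓ (x ⊓ x) ≡ x ⊓ x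
  ⊓-square-idem x = begin
    (x ⊓ x) ⊓ (x ⊓ x) ≡⟨ ⊓-idem-l x (x ⊓ x) ⟩
    x ⊓ (x ⊓ x)       ≡⟨ ⊓-comm x (x ⊓ x) ⟩
    (x ⊓ x) ⊓ x       ≡⟨ ⊓-idem-l x x ⟩
    x ⊓ x             ∎

  ⊓-⊤ : ∀ x → x ⊓ ⊤ ≡ x ⊓ x
  ⊓-⊤ x = Eq.trans (cong (x ⊓_) (sym (⊔-compl x))) (⊓-abs-⊔ x (⌟ x))

  ⊓-⊤⊓⊤ : ∀ {x} → x ⊓ x ≡ x → x ⊓ (⊤ ⊓ ⊤) ≡ x
  ⊓-⊤⊓⊤ {x} x-idem = begin
    x ⊓ (⊤ ⊓ ⊤) ≡⟨ sym (⊓-assoc x ⊤ ⊤) ⟩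
    (x ⊓ ⊤) ⊓ ⊤ ≡⟨ cong (_⊓ ⊤) x⊓⊤≡x ⟩
    x ⊓ ⊤       ≡⟨ x⊓⊤≡x ⟩
    x           ∎
    where
    x⊓⊤≡x : x ⊓ ⊤ ≡ x
    x⊓⊤≡x = Eq.trans (⊓-⊤ x) x-idem

  ∨-comm : ∀ x y → x ∨ y ≡ y ∨ x
  ∨-comm x y = cong ¬_ (⊓-comm (¬ x) (¬ y))

  ∨-idem : ∀ {x} → x ⊓ x ≡ x → x ∨ x ≡ x
  ∨-idem {x} x-idem = begin
    ¬ (¬ x ⊓ ¬ x)  ≡⟨ ¬-⊓-idem (¬ x) ⟩
    ¬ (¬ x)        ≡⟨ cong (λ t → ¬ (¬ t)) (sym x-idem) ⟩
    ¬ (¬ (x ⊓ x))  ≡⟨ ¬¬-⊓ x x ⟩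
    x ⊓ x          ≡⟨ x-idem ⟩
    x              ∎

  ∨-absorbs-⊓ : ∀ {x} → x ⊓ x ≡ x → ∀ w → x ∨ (x ⊓ w) ≡ x
  ∨-absorbs-⊓ {x} x-idem w = begin
    x ∨ (x ⊓ w)       ≡⟨ cong (_∨ (x ⊓ w)) (sym x-idem) ⟩
    (x ⊓ x) ∨ (x ⊓ w) ≡⟨ sym (⊓-distrib-∨ x x w) ⟩
    x ⊓ (x ∨ w)       ≡⟨ ⊓-abs-∨ x w ⟩
    x ⊓ x             ≡⟨ x-idem ⟩
    x                 ∎

  ⊓-∨-absorb : ∀ {x} → x ⊓ x ≡ x → ∀ w → (w ∨ x) ⊓ x ≡ x
  ⊓-∨-absorb {x} x-idem w = begin
    (w ∨ x) ⊓ x ≡⟨ ⊓-comm (w ∨ x) x ⟩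
    x ⊓ (w ∨ x) ≡⟨ cong (x ⊓_) (∨-comm w x) ⟩
    x ⊓ (x ∨ w) ≡⟨ ⊓-abs-∨ x w ⟩
    x ⊓ x       ≡⟨ x-idem ⟩
    x           ∎

  majority : Carrier → Carrier → Carrier → Carrier
  majority p w q = (p ⊓ w) ∨ ((p ∨ w) ⊓ q)

  majority-ppq : ∀ {p} → p ⊓ p ≡ p → ∀ q → majority p p q ≡ p
  majority-ppq {p} p-idem q = begin
    (p ⊓ p) ∨ ((p ∨ p) ⊓ q) ≡⟨ cong₂ (λ s t → s ∨ (t ⊓ q)) p-idem (∨-idem p-idem) ⟩
    p ∨ (p ⊓ q)             ≡⟨ ∨-absorbs-⊓ p-idem q ⟩
    p                       ∎

  majority-pqq : ∀ {q} → q ⊓ q ≡ q → ∀ p → majority p q q ≡ q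
  majority-pqq {q} q-idem p = begin
    (p ⊓ q) ∨ ((p ∨ q) ⊓ q) ≡⟨ cong ((p ⊓ q) ∨_) (⊓-∨-absorb q-idem p) ⟩
    (p ⊓ q) ∨ q             ≡⟨ ∨-comm (p ⊓ q) q ⟩
    q ∨ (p ⊓ q)             ≡⟨ cong (q ∨_) (⊓-comm p q) ⟩
    q ∨ (q ⊓ p)             ≡⟨ ∨-absorbs-⊓ q-idem p ⟩
    q                       ∎

  majority-pwp : ∀ {p} → p ⊓ p ≡ p → ∀ w → majority p w p ≡ p
  majority-pwp {p} p-idem w = begin
    (p ⊓ w) ∨ ((p ∨ w) ⊓ p) ≡⟨ cong ((p ⊓ w) ∨_) (begin
      (p ∨ w) ⊓ p              ≡⟨ ⊓-comm (p ∨ w) p ⟩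
      p ⊓ (p ∨ w)              ≡⟨ ⊓-abs-∨ p w ⟩
      p ⊓ p                    ≡⟨ p-idem ⟩
      p                        ∎) ⟩
    (p ⊓ w) ∨ p             ≡⟨ ∨-comm (p ⊓ w) p ⟩
    p ∨ (p ⊓ w)             ≡⟨ ∨-absorbs-⊓ p-idem w ⟩
    p                       ∎

  majority-preserves : (θ : Congruence D) → majority Preserves₃ Congruence.R θ
  majority-preserves θ p w q =
    ¬-cong (⊓-cong (¬-cong (⊓-cong p w)) (¬-cong (⊓-cong (∨-cong p w) q)))
    where
    open Congruence θ
    ∨-cong : _∨_ Preserves₂ R ⟶ R ⟶ R
    ∨-cong p w = ¬-cong (⊓-cong (¬-cong p) (¬-cong w))

  ⊓-squares-∩-Join⊆Join-∩ :
    (θ φ ψ : Congruence D) → let open Congruence in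
    ∀ {x y} → R θ x y → Join (R φ) (R ψ) x y → Join (R θ ∩ R φ) (R θ ∩ R ψ) (x ⊓ x) (y ⊓ y)
  ⊓-squares-∩-Join⊆Join-∩ θ φ ψ {x} {y} θxy j =
    majority⇒∩-Join⊆Join-∩ (isEquiv θ) (refl φ) (refl ψ)
      majority (majority-preserves θ) (majority-preserves φ) (majority-preserves ψ)
      (majority-pwp (⊓-square-idem x)) (majority-ppq (⊓-square-idem x) (y ⊓ y))
      (majority-pqq (⊓-square-idem y) (x ⊓ x))
      (⊓-cong θ θxy θxy) (Join-map (λ u → u ⊓ u) (λ r → ⊓-cong φ r r) (λ r → ⊓-cong ψ r r) j)
    where
    open Congruence
    refl : ∀ (χ : Congruence D) → Reflexive (R χ)
    refl χ = IsEquivalence.refl (isEquiv χ)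

module _ {a : Level} (D : DBA a) (triv : Trivial D) where
  open DBA D
  open ≡-Reasoning

  ⊓-⊔-idem⇒≡⊤⊓⊤ : ∀ {e} → e ⊓ e ≡ e → e ⊔ e ≡ e → e ≡ ⊤ ⊓ ⊤
  ⊓-⊔-idem⇒≡⊤⊓⊤ {e} ⊓-idem ⊔-idem = begin
    e                       ≡⟨ sym (⊓-⊤⊓⊤ D ⊓-idem) ⟩
    e ⊓ (⊤ ⊓ ⊤)             ≡⟨ ⊓-comm e (⊤ ⊓ ⊤) ⟩
    (⊤ ⊓ ⊤) ⊓ e             ≡⟨ cong ((⊤ ⊓ ⊤) ⊓_) (sym ⊤⊓⊤⊔e≡e) ⟩
    (⊤ ⊓ ⊤) ⊓ ((⊤ ⊓ ⊤) ⊔ e) ≡⟨ ⊓-abs-⊔ (⊤ ⊓ ⊤) e ⟩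
    (⊤ ⊓ ⊤) ⊓ (⊤ ⊓ ⊤)       ≡⟨ ⊓-square-idem D ⊤ ⟩
    ⊤ ⊓ ⊤                   ∎
    where
    ⊤⊓⊤⊔e≡e : (⊤ ⊓ ⊤) ⊔ e ≡ e
    ⊤⊓⊤⊔e≡e = begin
      (⊤ ⊓ ⊤) ⊔ e ≡⟨ ⊔-comm (⊤ ⊓ ⊤) e ⟩
      e ⊔ (⊤ ⊓ ⊤) ≡⟨ cong (e ⊔_) triv ⟩
      e ⊔ (⊥ ⊔ ⊥) ≡⟨ ⊓-⊤⊓⊤ (dual D) ⊔-idem ⟩
      e           ∎

  ⊓-idem⇒⊔-square≡⊤⊓⊤ : ∀ {x} → x ⊓ x ≡ x → x ⊔ x ≡ ⊤ ⊓ ⊤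
  ⊓-idem⇒⊔-square≡⊤⊓⊤ {x} x-idem =
    ⊓-⊔-idem⇒≡⊤⊓⊤ (sym (Eq.trans (cong (λ t → t ⊔ t) (sym x-idem)) (mixed x)))
                   (⊓-square-idem (dual D) x)

  ⊔-idem⇒⊓-square≡⊤⊓⊤ : ∀ {x} → x ⊔ x ≡ x → x ⊓ x ≡ ⊤ ⊓ ⊤
  ⊔-idem⇒⊓-square≡⊤⊓⊤ {x} x-idem =
    ⊓-⊔-idem⇒≡⊤⊓⊤ (⊓-square-idem D x) (Eq.trans (mixed x) (cong (λ t → t ⊓ t) x-idem))

  related-if-squares-related : Pure D → (J : Rel Carrier a) → Transitive J →
    ∀ {x y} → J (x ⊓ x) (y ⊓ y) → J (x ⊔ x) (y ⊔ y) → J x y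
  related-if-squares-related pure J J-trans {x} {y} j⊓ j⊔ with pure x | pure y
  ... | inj₁ x-idem | inj₁ y-idem = subst₂ J x-idem y-idem j⊓
  ... | inj₂ x-idem | inj₂ y-idem = subst₂ J x-idem y-idem j⊔
  ... | inj₁ x-idem | inj₂ y-idem =
    J-trans (subst₂ J x-idem (⊔-idem⇒⊓-square≡⊤⊓⊤ y-idem) j⊓)
            (subst₂ J (⊓-idem⇒⊔-square≡⊤⊓⊤ x-idem) y-idem j⊔)
  ... | inj₂ x-idem | inj₁ y-idem =
    J-trans (subst₂ J x-idem (⊓-idem⇒⊔-square≡⊤⊓⊤ y-idem) j⊔)
            (subst₂ J (⊔-idem⇒⊓-square≡⊤⊓⊤ x-idem) y-idem j⊓)

corollary3p10 : ∀ {a : Level} (D : DBA a) → Pure D → Trivial D → ConDistributive D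
corollary3p10 D pure triv θ φ ψ =
  ∩-Join⊆Join-∩ , Join-∩⊆∩-Join (IsEquivalence.trans (isEquiv θ))
  where
  open Congruence

  ∩-Join⊆Join-∩ : ∀ {x y} → (R θ ∩ Join (R φ) (R ψ)) x y → Join (R θ ∩ R φ) (R θ ∩ R ψ) x y
  ∩-Join⊆Join-∩ (θxy , j) =
    related-if-squares-related D triv pure (Join (R θ ∩ R φ) (R θ ∩ R ψ)) trans
      (⊓-squares-∩-Join⊆Join-∩ D θ φ ψ θxy j)
      (⊓-squares-∩-Join⊆Join-∩ (dual D)
        (Congruence-dual θ) (Congruence-dual φ) (Congruence-dual ψ) θxy j)
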